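{- Let $\sigma$ be a vincular pattern, let $\lambda$ be a Young board, and let $C\subseteq[\operatorname{width}(\lambda)]$ and $R\subseteq[\operatorname{height}(\lambda)]$. Then the map that deletes the rows in $R$ is a bijection from $\mathcal{S}_\lambda^{C,R}(\sigma)$ onto $\mathcal{S}_{\lambda^{(\emptyset,R)}}^{C,\emptyset}(\sigma)$.
   Context: A vincular pattern of length $k$ is a pair $(\sigma,X)$ with $\sigma\in S_k$ and $X\subseteq[k-1]$. A Young board $\lambda=(\lambda_1,\dots,\lambda_n)$ with $\lambda_1\ge\dots\ge\lambda_n>0$ is the cell set $\{(i,j):1\le i\le n,\ 1\le j\le\lambda_i\}$, with width $n$ and height $\lambda_1$. A filling is a $0/1$ assignment to the cells with at most one $1$ per row and per column. It is encoded by the word $\pi_1\cdots\pi_n$ with $\pi_c=r$ if $(c,r)$ holds a $1$ and $\pi_c=\square$ if column $c$ is empty. A filling $\pi$ contains $(\sigma,X)$ if there are $i_1<\dots<i_k$ such that all of the following hold: - all $\pi_{i_j}$ are numbers; - $\pi_{i_1}\cdots\pi_{i_k}$ is order-isomorphic to $\sigma$; - $i_{j+1}=i_j+1$ for $j\in X$; - the cell $(i_k,\max_j\pi_{i_j})$ lies in $\lambda$. Otherwise $\pi$ avoids $(\sigma,X)$. $\mathcal{S}_\lambda^{C,R}(\sigma)$ denotes the set of fillings of $\lambda$ whose empty columns are exactly $C$ and empty rows exactly $R$, and which avoid $\sigma$. $\lambda^{(\emptyset,R)}$ is the Young board obtained from $\lambda$ by deleting the rows in $R$ and re-indexing the remaining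 rows. -}

module Defs where

open import Data.Nat using (ℕ; zero; suc; _+_; _∸_; _≤_; _<_; _⊔_)
open import Data.Bool using (Bool; true; false; if_then_else_)
open import Data.Fin using (Fin; toℕ; inject₁; fromℕ) renaming (zero to fzero; suc to fsuc)
open import Data.Fin.Subset using (Subset; _∈_; _∉_)
open import Data.Fin.Permutation using (Permutation′; _⟨$⟩ʳ_)
open import Data.Vec using (Vec; lookup; foldr; map)
open import Data.Maybe using (Maybe; just; nothing)
import Data.Maybe as Maybe
open import Data.Product using (Σ; ∃; _×_; _,_)
open import Function.Bundles using (_⇔_)
open import Relation.Binary.PropositionalEquality using (_≡_; _≢_)
open import Relation.Nullary using (¬_)

-- A board of width n is the vector of column heights
-- (λ₁ , … , λₙ); columns are indexed by Fin n (column c of the paper is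
-- index c-1), rows are 1-based natural numbers.

Board : ℕ → Set
Board n = Vec ℕ n

record IsYoungBoard {n : ℕ} (λ′ : Board n) : Set where
  field
    decreasing : ∀ (i j : Fin n) → toℕ i ≤ toℕ j → lookup λ′ j ≤ lookup λ′ i
    positive   : ∀ (i : Fin n) → 0 < lookup λ′ i

-- height = λ₁ (written as the maximum, which is λ₁ for a Young board
-- and 0 for the empty board)
height : {n : ℕ} → Board n → ℕ
height = foldr _ _⊔_ 0

InBoard : {n : ℕ} → Board n → Fin n → ℕ → Set
InBoard λ′ c r = (1 ≤ r) × (r ≤ lookup λ′ c)

-- Words / fillings: π_c = just r  (a 1 in cell (c , r)),
--                   π_c = nothing (column c empty, the paper's □).

Word : ℕ → Set
Word n = Vec (Maybe ℕ) n

record IsFilling {n : ℕ} (λ′ : Board n) (π : Word n) : Set where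
  field
    inBoard  : ∀ (c : Fin n) (r : ℕ) → lookup π c ≡ just r → InBoard λ′ c r
    rowInj   : ∀ (c d : Fin n) (r : ℕ) → lookup π c ≡ just r → lookup π d ≡ just r → c ≡ d

-- Vincular patterns (σ , X) of length k = suc m  (k ≥ 1).
-- Pattern positions are Fin (suc m) (position j of the paper is index
-- j-1); X ⊆ [k-1] is a Subset m, where x ∈ X demands that pattern
-- positions inject₁ x and fsuc x be adjacent (i_{x+1} = i_x + 1).

record Vincular (m : ℕ) : Set where
  constructor vinc
  field
    σ : Permutation′ (suc m)
    X : Subset m

maxF : {k : ℕ} → (Fin k → ℕ) → ℕ
maxF {zero}  v = 0
maxF {suc k} v = v fzero ⊔ maxF (λ j → v (fsuc j))

Contains : {n m : ℕ} → Board n → Vincular m → Word n → Set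
Contains {n} {m} λ′ (vinc σ X) π =
  Σ (Fin (suc m) → Fin n) λ i →
  Σ (Fin (suc m) → ℕ) λ v →
      (∀ (a b : Fin (suc m)) → toℕ a < toℕ b → toℕ (i a) < toℕ (i b))
    × (∀ (a : Fin (suc m)) → lookup π (i a) ≡ just (v a))
    × (∀ (a b : Fin (suc m)) → (v a < v b) ⇔ (toℕ (σ ⟨$⟩ʳ a) < toℕ (σ ⟨$⟩ʳ b)))
    × (∀ (x : Fin m) → x ∈ X → toℕ (i (fsuc x)) ≡ suc (toℕ (i (inject₁ x))))
    × InBoard λ′ (i (fromℕ m)) (maxF v)

Avoids : {n m : ℕ} → Board n → Vincular m → Word n → Set
Avoids λ′ p π = ¬ Contains λ′ p π

RowSet : Set
RowSet = ℕ → Bool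

∅R : RowSet
∅R _ = false

countR : RowSet → ℕ → ℕ
countR R zero    = 0
countR R (suc r) = countR R r + (if R (suc r) then 1 else 0)

record InS {n m : ℕ} (λ′ : Board n) (C : Subset n) (R : RowSet)
           (p : Vincular m) (π : Word n) : Set where
  field
    filling   : IsFilling λ′ π
    emptyCols : ∀ (c : Fin n) → (lookup π c ≡ nothing) ⇔ (c ∈ C)
    emptyRows : ∀ (r : ℕ) → 1 ≤ r → r ≤ height λ′ →
                  (∀ (c : Fin n) → lookup π c ≢ just r) ⇔ (R r ≡ true)
    avoids    : Avoids λ′ p π

delRow : RowSet → ℕ → ℕ
delRow R r = r ∸ countR R r

-- the board λ^{(∅,R)}: column c keeps its cells in rows not in R
delBoard : {n : ℕ} → RowSet → Board n → Board n
delBoard R λ′ = map (λ h → h ∸ countR R h) λ′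

delWord : {n : ℕ} → RowSet → Word n → Word n
delWord R π = map (Maybe.map (delRow R)) π

module Submission where

-- Write D = delRow R for the relabelling r ↦ r ∸ #{r′ ∈ R : r′ ≤ r} of the
-- rows of λ.  Restricted to rows outside R, D is strictly increasing, so it
-- is an order embedding there; it sends the rows of [1, h] outside R onto
-- [1, D h]; and being monotone with D 0 = 0 it commutes with maxima, hence
-- with board heights and with the "top row" of a pattern occurrence.
--
-- A filling π ∈ S^{C,R}_λ(σ) is R-free: since R is exactly its set of empty
-- rows, every entry of π lies in a row outside R.  On R-free words, deleting
-- the rows of R merely relabels the entries along the order embedding D.
-- Consequently deletion preserves and reflects the filling conditions, the
-- empty columns and every occurrence of a vincular pattern; it is injective;
-- and any filling of the deleted board lifts entrywise to an R-free word.

open import Defs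
open import Data.Nat using (ℕ; _≤_; _<_)
open import Data.Bool using (true)
open import Data.Fin.Subset using (Subset)
open import Data.Product using (Σ; _×_)
open import Relation.Binary.PropositionalEquality using (_≡_)

open import Data.Nat using (zero; suc; _⊔_; z≤n; s≤s; _≤′_; ≤′-refl; ≤′-step)
open import Data.Nat.Properties
open import Data.Bool using (false)
open import Data.Fin using (Fin; toℕ; fromℕ) renaming (zero to fzero; suc to fsuc)
open import Data.Fin.Permutation using (_⟨$⟩ʳ_)
open import Data.Vec using (Vec; []; _∷_; lookup; tabulate; map)
open import Data.Vec.Properties using (lookup-map; lookup∘tabulate; tabulate∘lookup; tabulate-cong)
open import Data.Maybe using (Maybe; just; nothing)
import Data.Maybe as Maybe
open import Data.Maybe.Properties using (just-injective)
open import Data.Product using (_,_; proj₁; proj₂)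
open import Data.Sum using (_⊎_; inj₁; inj₂)
open import Data.Empty using (⊥-elim)
open import Function using (_∘_)
open import Function.Bundles using (_⇔_; mk⇔; Equivalence)
open import Function.Construct.Composition using (_⇔-∘_)
open import Function.Construct.Symmetry using (⇔-sym)
open import Relation.Binary using (_Preserves_⟶_)
open import Relation.Binary.PropositionalEquality
  using (refl; sym; trans; cong; cong₂; subst; subst₂; _≢_; module ≡-Reasoning)
open import Relation.Nullary using (¬_; yes; no)

open Equivalence using (to; from)

module RowArithmetic (R : RowSet) where

  D : ℕ → ℕ
  D = delRow R

  -- at most r of the rows 1 … r lie in R, so the subtraction in D is exact
  countR≤ : ∀ r → countR R r ≤ r
  countR≤ zero = z≤n
  countR≤ (suc r) with R (suc r)
  ... | true  rewrite +-comm (countR R r) 1 = s≤s (countR≤ r)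
  ... | false rewrite +-identityʳ (countR R r) = m≤n⇒m≤1+n (countR≤ r)

  delRow-suc-∈ : ∀ r → R (suc r) ≡ true → D (suc r) ≡ D r
  delRow-suc-∈ r eq rewrite eq | +-comm (countR R r) 1 = refl

  delRow-suc-∉ : ∀ r → R (suc r) ≡ false → D (suc r) ≡ suc (D r)
  delRow-suc-∉ r eq rewrite eq | +-identityʳ (countR R r) = +-∸-assoc 1 (countR≤ r)

  -- case split on membership without abstracting R r in the goal
  deleted-or-kept : ∀ r → R r ≡ true ⊎ R r ≡ false
  deleted-or-kept r with R r
  ... | true  = inj₁ refl
  ... | false = inj₂ refl

  delRow-step : ∀ r → D r ≤ D (suc r)
  delRow-step r with deleted-or-kept (suc r)
  ... | inj₁ eq = ≤-reflexive (sym (delRow-suc-∈ r eq))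
  ... | inj₂ eq = ≤-trans (n≤1+n (D r)) (≤-reflexive (sym (delRow-suc-∉ r eq)))

  delRow-mono : D Preserves _≤_ ⟶ _≤_
  delRow-mono p = go (≤⇒≤′ p)
    where
    go : ∀ {r s} → r ≤′ s → D r ≤ D s
    go ≤′-refl         = ≤-refl
    go (≤′-step {s} q) = ≤-trans (go q) (delRow-step s)

  delRow-<-kept : ∀ {r s} → r < s → R s ≡ false → D r < D s
  delRow-<-kept {r} {suc s} (s≤s r≤s) eq rewrite delRow-suc-∉ s eq = s≤s (delRow-mono r≤s)

  delRow-pos : ∀ {r} → R r ≡ false → 1 ≤ r → 1 ≤ D r
  delRow-pos {suc r} eq _ rewrite delRow-suc-∉ r eq = s≤s z≤n

  delRow-<⇔ : ∀ {x y} → R y ≡ false → (x < y) ⇔ (D x < D y)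
  delRow-<⇔ {x} {y} y∉R = mk⇔ (λ x<y → delRow-<-kept x<y y∉R) reflect
    where
    reflect : D x < D y → x < y
    reflect Dx<Dy with x <? y
    ... | yes x<y = x<y
    ... | no  x≮y = ⊥-elim (<⇒≱ Dx<Dy (delRow-mono (≮⇒≥ x≮y)))

  delRow-≤-reflect : ∀ {x y} → R x ≡ false → D x ≤ D y → x ≤ y
  delRow-≤-reflect x∉R Dx≤Dy = ≮⇒≥ λ y<x → <⇒≱ (to (delRow-<⇔ x∉R) y<x) Dx≤Dy

  delRow-injective : ∀ {x y} → R x ≡ false → R y ≡ false → D x ≡ D y → x ≡ y
  delRow-injective x∉R y∉R e =
    ≤-antisym (delRow-≤-reflect x∉R (≤-reflexive e)) (delRow-≤-reflect y∉R (≤-reflexive (sym e)))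

  record KeptPreimage (h r′ : ℕ) : Set where
    field
      row   : ℕ
      pos   : 1 ≤ row
      bound : row ≤ h
      kept  : R row ≡ false
      image : D row ≡ r′

  private
    widen : ∀ {h r′} → KeptPreimage h r′ → KeptPreimage (suc h) r′
    widen record { row = r ; pos = p ; bound = b ; kept = k ; image = i } =
      record { row = r ; pos = p ; bound = m≤n⇒m≤1+n b ; kept = k ; image = i }

  delRow-onto : ∀ h {r′} → 1 ≤ r′ → r′ ≤ D h → KeptPreimage h r′
  delRow-onto zero     1≤r′ r′≤0 = ⊥-elim (<⇒≱ 1≤r′ r′≤0)
  delRow-onto (suc h) {r′} 1≤r′ r′≤ with deleted-or-kept (suc h)
  ... | inj₁ eq = widen (delRow-onto h 1≤r′ (subst (r′ ≤_) (delRow-suc-∈ h eq) r′≤))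
  ... | inj₂ eq with m≤n⇒m<n∨m≡n (subst (r′ ≤_) (delRow-suc-∉ h eq) r′≤)
  ...   | inj₁ (s≤s r′≤Dh) = widen (delRow-onto h 1≤r′ r′≤Dh)
  ...   | inj₂ r′≡        = record { row = suc h ; pos = s≤s z≤n ; bound = ≤-refl ; kept = eq
                                   ; image = trans (delRow-suc-∉ h eq) (sym r′≡) }

  KeptEntry : ℕ → Maybe ℕ → Set
  KeptEntry h x = ∀ r → x ≡ just r → (1 ≤ r × r ≤ h) × R r ≡ false

  lift-entry : ∀ h (y : Maybe ℕ) → (∀ r′ → y ≡ just r′ → 1 ≤ r′ × r′ ≤ D h) →
               Σ (Maybe ℕ) λ x → KeptEntry h x × Maybe.map D x ≡ y
  lift-entry h nothing   _      = nothing , (λ _ ()) , refl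
  lift-entry h (just r′) bounds = just row , (λ { _ refl → (pos , bound) , kept }) , cong just image
    where open KeptPreimage (delRow-onto h (proj₁ (bounds r′ refl)) (proj₂ (bounds r′ refl)))

maxF-cong : ∀ {k} {v w : Fin k → ℕ} → (∀ a → v a ≡ w a) → maxF v ≡ maxF w
maxF-cong {zero}  v≡w = refl
maxF-cong {suc k} v≡w = cong₂ _⊔_ (v≡w fzero) (maxF-cong (v≡w ∘ fsuc))

-- a nonempty maximum is one of its arguments, so it inherits any property
-- shared by all of them
maxF-inherits : ∀ {k} (P : ℕ → Set) (v : Fin (suc k) → ℕ) → (∀ a → P (v a)) → P (maxF v)
maxF-inherits {zero}  P v Pv = subst P (sym (⊔-identityʳ (v fzero))) (Pv fzero)
maxF-inherits {suc k} P v Pv with ⊔-sel (v fzero) (maxF (v ∘ fsuc))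
... | inj₁ max≡v0   = subst P (sym max≡v0) (Pv fzero)
... | inj₂ max≡rest = subst P (sym max≡rest) (maxF-inherits P (v ∘ fsuc) (Pv ∘ fsuc))

maxF-map : ∀ {f : ℕ → ℕ} → f Preserves _≤_ ⟶ _≤_ → f 0 ≡ 0 →
           ∀ {k} (v : Fin k → ℕ) → maxF (f ∘ v) ≡ f (maxF v)
maxF-map         mono f0 {zero}  v = sym f0
maxF-map {f = f} mono f0 {suc k} v = begin
  f (v fzero) ⊔ maxF (f ∘ v ∘ fsuc) ≡⟨ cong (f (v fzero) ⊔_) (maxF-map mono f0 (v ∘ fsuc)) ⟩
  f (v fzero) ⊔ f (maxF (v ∘ fsuc)) ≡⟨ sym (mono-≤-distrib-⊔ mono (v fzero) _) ⟩
  f (maxF v)                        ∎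
  where open ≡-Reasoning

height-map : ∀ {f : ℕ → ℕ} → f Preserves _≤_ ⟶ _≤_ → f 0 ≡ 0 →
             ∀ {n} (l : Vec ℕ n) → height (map f l) ≡ f (height l)
height-map mono f0 []       = sym f0
height-map mono f0 (x ∷ xs) =
  trans (cong (_ ⊔_) (height-map mono f0 xs)) (sym (mono-≤-distrib-⊔ mono x _))

lookup≤height : ∀ {n} (l : Vec ℕ n) (c : Fin n) → lookup l c ≤ height l
lookup≤height (x ∷ l) fzero    = m≤m⊔n x _
lookup≤height (x ∷ l) (fsuc c) = ≤-trans (lookup≤height l c) (m≤n⊔m x _)

RFree : ∀ {n} → RowSet → Word n → Set
RFree {n} R π = ∀ (c : Fin n) r → lookup π c ≡ just r → R r ≡ false

vec-ext : ∀ {A : Set} {n} {xs ys : Vec A n} → (∀ i → lookup xs i ≡ lookup ys i) → xs ≡ ys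
vec-ext {xs = xs} {ys} p = trans (sym (tabulate∘lookup xs)) (trans (tabulate-cong p) (tabulate∘lookup ys))

module Deletion (R : RowSet) {n : ℕ} where

  open RowArithmetic R

  lookup-delWord : ∀ (π : Word n) c → lookup (delWord R π) c ≡ Maybe.map D (lookup π c)
  lookup-delWord π c = lookup-map c (Maybe.map D) π

  lookup-delBoard : ∀ (L : Board n) c → lookup (delBoard R L) c ≡ D (lookup L c)
  lookup-delBoard L c = lookup-map c D L

  height-delBoard : ∀ (L : Board n) → height (delBoard R L) ≡ D (height L)
  height-delBoard = height-map delRow-mono refl

  delWord-just : ∀ (π : Word n) {c r} → lookup π c ≡ just r → lookup (delWord R π) c ≡ just (D r)
  delWord-just π {c} e = trans (lookup-delWord π c) (cong (Maybe.map D) e)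

  delWord-just⁻ : ∀ (π : Word n) {c r′} → lookup (delWord R π) c ≡ just r′ →
                  Σ ℕ λ r → lookup π c ≡ just r × D r ≡ r′
  delWord-just⁻ π {c} e = preimage (lookup π c) (trans (sym (lookup-delWord π c)) e)
    where
    preimage : ∀ (x : Maybe ℕ) {r′} → Maybe.map D x ≡ just r′ → Σ ℕ λ r → x ≡ just r × D r ≡ r′
    preimage (just r) refl = r , refl , refl

  delWord-nothing : ∀ (π : Word n) c → (lookup (delWord R π) c ≡ nothing) ⇔ (lookup π c ≡ nothing)
  delWord-nothing π c = mk⇔ (reflect (lookup π c) ∘ trans (sym (lookup-delWord π c)))
                            (λ e → trans (lookup-delWord π c) (cong (Maybe.map D) e))
    where
    reflect : ∀ (x : Maybe ℕ) → Maybe.map D x ≡ nothing → x ≡ nothing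
    reflect nothing _ = refl

  delWord-injective : ∀ {π π′ : Word n} → RFree R π → RFree R π′ →
                      delWord R π ≡ delWord R π′ → π ≡ π′
  delWord-injective {π} {π′} free free′ e = vec-ext λ c →
    entry (lookup π c) (lookup π′ c) (free c) (free′ c)
      (trans (sym (lookup-delWord π c)) (trans (cong (λ w → lookup w c) e) (lookup-delWord π′ c)))
    where
    entry : ∀ (x y : Maybe ℕ) → (∀ r → x ≡ just r → R r ≡ false) → (∀ r → y ≡ just r → R r ≡ false) →
            Maybe.map D x ≡ Maybe.map D y → x ≡ y
    entry nothing  nothing  _  _  _ = refl
    entry (just r) (just s) kx ky e = cong just (delRow-injective (kx r refl) (ky s refl) (just-injective e))

  module _ (L : Board n) where

    delWord-filling : ∀ {π} → IsFilling L π → RFree R π → IsFilling (delBoard R L) (delWord R π)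
    delWord-filling {π} fill free = record { inBoard = inBoard′ ; rowInj = rowInj′ }
      where
      open IsFilling fill
      inBoard′ : ∀ c r′ → lookup (delWord R π) c ≡ just r′ → InBoard (delBoard R L) c r′
      inBoard′ c r′ e with delWord-just⁻ π e
      ... | r , πc≡r , refl =
        delRow-pos (free c r πc≡r) (proj₁ (inBoard c r πc≡r)) ,
        subst (D r ≤_) (sym (lookup-delBoard L c)) (delRow-mono (proj₂ (inBoard c r πc≡r)))
      rowInj′ : ∀ c d r′ → lookup (delWord R π) c ≡ just r′ → lookup (delWord R π) d ≡ just r′ → c ≡ d
      rowInj′ c d r′ e e′ with delWord-just⁻ π e | delWord-just⁻ π e′
      ... | r , πc≡r , Dr≡r′ | s , πd≡s , Ds≡r′ =
        rowInj c d r πc≡r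
          (subst (λ x → lookup π d ≡ just x)
                 (delRow-injective (free d s πd≡s) (free c r πc≡r) (trans Ds≡r′ (sym Dr≡r′))) πd≡s)

    lift-word : ∀ {τ} → IsFilling (delBoard R L) τ →
                Σ (Word n) λ π → (∀ c → KeptEntry (lookup L c) (lookup π c)) × delWord R π ≡ τ
    lift-word {τ} fill = π , kept-entries , delπ≡τ
      where
      lifted : ∀ c → Σ (Maybe ℕ) λ x → KeptEntry (lookup L c) x × Maybe.map D x ≡ lookup τ c
      lifted c = lift-entry (lookup L c) (lookup τ c) λ r′ e →
        subst (λ h → 1 ≤ r′ × r′ ≤ h) (lookup-delBoard L c) (IsFilling.inBoard fill c r′ e)
      π : Word n
      π = tabulate (proj₁ ∘ lifted)
      kept-entries : ∀ c → KeptEntry (lookup L c) (lookup π c)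
      kept-entries c rewrite lookup∘tabulate (proj₁ ∘ lifted) c = proj₁ (proj₂ (lifted c))
      delπ≡τ : delWord R π ≡ τ
      delπ≡τ = vec-ext λ c → begin
        lookup (delWord R π) c          ≡⟨ lookup-delWord π c ⟩
        Maybe.map D (lookup π c)        ≡⟨ cong (Maybe.map D) (lookup∘tabulate (proj₁ ∘ lifted) c) ⟩
        Maybe.map D (proj₁ (lifted c))  ≡⟨ proj₂ (proj₂ (lifted c)) ⟩
        lookup τ c                      ∎
        where open ≡-Reasoning

    lift-filling : ∀ {π} → (∀ c → KeptEntry (lookup L c) (lookup π c)) →
                   IsFilling (delBoard R L) (delWord R π) → IsFilling L π
    lift-filling {π} kept fill = record
      { inBoard = λ c r e → proj₁ (kept c r e)
      ; rowInj  = λ c d r e e′ → IsFilling.rowInj fill c d (D r) (delWord-just π e) (delWord-just π e′) }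

    contains-del : ∀ {m} (p : Vincular m) {π} → RFree R π →
                   Contains L p π → Contains (delBoard R L) p (delWord R π)
    contains-del {m} (vinc σ X) {π} free (i , v , increasing , values , order , adjacent , (top≥1 , top≤)) =
      i , D ∘ v , increasing , values′ , order′ , adjacent , top′
      where
      kept : ∀ a → R (v a) ≡ false
      kept a = free (i a) (v a) (values a)
      values′ : ∀ a → lookup (delWord R π) (i a) ≡ just (D (v a))
      values′ a = delWord-just π (values a)
      order′ : ∀ a b → (D (v a) < D (v b)) ⇔ (toℕ (σ ⟨$⟩ʳ a) < toℕ (σ ⟨$⟩ʳ b))
      order′ a b = order a b ⇔-∘ ⇔-sym (delRow-<⇔ (kept b))
      top′ : InBoard (delBoard R L) (i (fromℕ m)) (maxF (D ∘ v))
      top′ = subst (InBoard (delBoard R L) (i (fromℕ m))) (sym (maxF-map delRow-mono refl v))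
               ( delRow-pos (maxF-inherits (λ r → R r ≡ false) v kept) top≥1
               , subst (D (maxF v) ≤_) (sym (lookup-delBoard L _)) (delRow-mono top≤))

    contains-del⁻ : ∀ {m} (p : Vincular m) {π} → IsFilling L π → RFree R π →
                    Contains (delBoard R L) p (delWord R π) → Contains L p π
    contains-del⁻ {m} (vinc σ X) {π} fill free (i , w , increasing , values , order , adjacent , (_ , top≤)) =
      i , v , increasing , values′ , order′ , adjacent , (top≥1′ , top≤′)
      where
      preimage : ∀ a → Σ ℕ λ r → lookup π (i a) ≡ just r × D r ≡ w a
      preimage a = delWord-just⁻ π (values a)
      v : Fin (suc m) → ℕ
      v a = proj₁ (preimage a)
      values′ : ∀ a → lookup π (i a) ≡ just (v a)
      values′ a = proj₁ (proj₂ (preimage a))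
      image : ∀ a → D (v a) ≡ w a
      image a = proj₂ (proj₂ (preimage a))
      kept : ∀ a → R (v a) ≡ false
      kept a = free (i a) (v a) (values′ a)
      order′ : ∀ a b → (v a < v b) ⇔ (toℕ (σ ⟨$⟩ʳ a) < toℕ (σ ⟨$⟩ʳ b))
      order′ a b = subst₂ (λ x y → (x < y) ⇔ _) (sym (image a)) (sym (image b)) (order a b)
                       ⇔-∘ delRow-<⇔ (kept b)
      top≥1′ : 1 ≤ maxF v
      top≥1′ = maxF-inherits (1 ≤_) v λ a → proj₁ (IsFilling.inBoard fill (i a) (v a) (values′ a))
      top≤′ : maxF v ≤ lookup L (i (fromℕ m))
      top≤′ = delRow-≤-reflect (maxF-inherits (λ r → R r ≡ false) v kept)
                (subst₂ _≤_ (trans (maxF-cong (sym ∘ image)) (maxF-map delRow-mono refl v))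
                            (lookup-delBoard L _) top≤)

module Bijection {n m : ℕ} (p : Vincular m) (L : Board n) (C : Subset n) (R : RowSet) where

  open RowArithmetic R
  open Deletion R

  private
    true≢false : true ≢ false
    true≢false ()

  -- the rows of R are the empty rows of π, so π is R-free
  InS-RFree : ∀ {π} → InS L C R p π → RFree R π
  InS-RFree {π} S c r πc≡r with deleted-or-kept r
  ... | inj₂ r∉R = r∉R
  ... | inj₁ r∈R = ⊥-elim (from (InS.emptyRows S r 1≤r (≤-trans r≤λc (lookup≤height L c))) r∈R c πc≡r)
    where
    open IsFilling (InS.filling S)
    1≤r : 1 ≤ r
    1≤r = proj₁ (inBoard c r πc≡r)
    r≤λc : r ≤ lookup L c
    r≤λc = proj₂ (inBoard c r πc≡r)

  -- every row of the deleted board is occupied: it is D r for a kept, hence occupied, row r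
  delWord-occupies : ∀ {π} → InS L C R p π → ∀ {r′} → 1 ≤ r′ → r′ ≤ height (delBoard R L) →
                     ¬ (∀ c → lookup (delWord R π) c ≢ just r′)
  delWord-occupies {π} S 1≤r′ r′≤ r′-empty =
    true≢false (trans (sym (to (InS.emptyRows S row pos bound) row-empty)) kept)
    where
    open KeptPreimage (delRow-onto (height L) 1≤r′ (subst (_ ≤_) (height-delBoard L) r′≤))
    row-empty : ∀ c → lookup π c ≢ just row
    row-empty c πc≡row = r′-empty c (trans (delWord-just π πc≡row) (cong just image))

  delete-into : ∀ π → InS L C R p π → InS (delBoard R L) C ∅R p (delWord R π)
  delete-into π S = record
    { filling   = delWord-filling L fill free
    ; emptyCols = λ c → InS.emptyCols S c ⇔-∘ delWord-nothing π c
    ; emptyRows = λ r′ 1≤r′ r′≤ → mk⇔ (⊥-elim ∘ delWord-occupies S 1≤r′ r′≤) λ ()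
    ; avoids    = InS.avoids S ∘ contains-del⁻ L p fill free
    }
    where
    fill : IsFilling L π
    fill = InS.filling S
    free : RFree R π
    free = InS-RFree S

  delete-injective : ∀ π π′ → InS L C R p π → InS L C R p π′ → delWord R π ≡ delWord R π′ → π ≡ π′
  delete-injective _ _ S S′ = delWord-injective (InS-RFree S) (InS-RFree S′)

  -- if π is R-free and its deletion has no empty rows, then the empty rows of π are
  -- exactly R: a kept row r of λ is occupied in π because D r is occupied after deletion
  lifted-emptyRows : ∀ {π} → RFree R π → InS (delBoard R L) C ∅R p (delWord R π) →
                     ∀ r → 1 ≤ r → r ≤ height L → (∀ c → lookup π c ≢ just r) ⇔ (R r ≡ true)
  lifted-emptyRows {π} free T r 1≤r r≤h = mk⇔ deleted (λ r∈R c e → true≢false (trans (sym r∈R) (free c r e)))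
    where
    occupied : R r ≡ false → ¬ (∀ c → lookup π c ≢ just r)
    occupied r∉R r-empty = true≢false (sym (to (InS.emptyRows T (D r) 1≤Dr Dr≤h) Dr-empty))
      where
      1≤Dr : 1 ≤ D r
      1≤Dr = delRow-pos r∉R 1≤r
      Dr≤h : D r ≤ height (delBoard R L)
      Dr≤h = subst (D r ≤_) (sym (height-delBoard L)) (delRow-mono r≤h)
      Dr-empty : ∀ c → lookup (delWord R π) c ≢ just (D r)
      Dr-empty c e with delWord-just⁻ π e
      ... | s , πc≡s , Ds≡Dr =
        r-empty c (subst (λ x → lookup π c ≡ just x) (delRow-injective (free c s πc≡s) r∉R Ds≡Dr) πc≡s)
    deleted : (∀ c → lookup π c ≢ just r) → R r ≡ true
    deleted r-empty with deleted-or-kept r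
    ... | inj₁ r∈R = r∈R
    ... | inj₂ r∉R = ⊥-elim (occupied r∉R r-empty)

  delete-onto : ∀ τ → InS (delBoard R L) C ∅R p τ → Σ (Word n) λ π → InS L C R p π × delWord R π ≡ τ
  delete-onto τ T = π , S , delπ≡τ
    where
    lifted : Σ (Word n) λ π → (∀ c → KeptEntry (lookup L c) (lookup π c)) × delWord R π ≡ τ
    lifted = lift-word L (InS.filling T)
    π : Word n
    π = proj₁ lifted
    kept : ∀ c → KeptEntry (lookup L c) (lookup π c)
    kept = proj₁ (proj₂ lifted)
    delπ≡τ : delWord R π ≡ τ
    delπ≡τ = proj₂ (proj₂ lifted)
    T′ : InS (delBoard R L) C ∅R p (delWord R π)
    T′ = subst (InS (delBoard R L) C ∅R p) (sym delπ≡τ) T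
    free : RFree R π
    free c r e = proj₂ (kept c r e)
    S : InS L C R p π
    S = record
      { filling   = lift-filling L kept (InS.filling T′)
      ; emptyCols = λ c → InS.emptyCols T′ c ⇔-∘ ⇔-sym (delWord-nothing π c)
      ; emptyRows = lifted-emptyRows free T′
      ; avoids    = InS.avoids T′ ∘ contains-del L p {π} free
      }

proposition1p4 : ∀ {n m : ℕ} (p : Vincular m) (λ′ : Board n) → IsYoungBoard λ′ →
    (C : Subset n) (R : RowSet) → (∀ (r : ℕ) → R r ≡ true → 1 ≤ r × r ≤ height λ′) →
    (∀ (π : Word n) → InS λ′ C R p π → InS (delBoard R λ′) C ∅R p (delWord R π))
    × (∀ (π π′ : Word n) → InS λ′ C R p π → InS λ′ C R p π′ →
    delWord R π ≡ delWord R π′ → π ≡ π′)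
    × (∀ (τ : Word n) → InS (delBoard R λ′) C ∅R p τ →
    Σ (Word n) (λ π → InS λ′ C R p π × delWord R π ≡ τ))
proposition1p4 p λ′ _ C R _ = delete-into , delete-injective , delete-onto
  where open Bijection p λ′ C R
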